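{- For the neighbourhood $\mathcal N_{BS-R}(x,p)$ of a DRP-E instance with $n_d$ destinations and $n_r$ replenishment locations, the associated operations state graph $\mathcal O$ has $O(n_d^2n_rp\cdot4^p)$ non-terminal states.
   Context: Setting: $V_d=\{v_1,\dots,v_{n_d}\}$ destinations, $V_r$ ($|V_r|=n_r$) replenishment locations (RLs) containing $w_0,w_t$. An operation is $wsw'=(w,v_{O1},\dots,v_{Ok},w')$ with $w,w'\in V_r$, $k\ge1$, distinct destinations; $\{s\}$ its destination set. A drone tour is an alternating sequence of recharging legs (pairs of RLs) and operations, from $w_0$ to $w_t$, consecutive pieces connected, visiting each destination exactly once (no energy constraint here); $\pi_d(V_d)$ is the visiting order of destinations. For $x=(v_1,\dots,v_{n_d})$, $p\in\mathbb N$ and a permutation $\sigma$ of $[n_d]$ ($\sigma(i)$ = new position of $v_i$): $(v_{\sigma^{ -1}(1)},\dots)\in\mathcal N_{BS}(x,p)$ iff $\sigma(i)<\sigma(j)$ whenever $i+p\le j$; $\mathcal N_{BS-R}(x,p)$ = drone tours with $\pi_d(V_d)\in\mathcal N_{BS}(x,p)$; an operation is $\mathcal N_{BS-R}$-valid if it occurs in some drone tour of $\mathcal N_{BS-R}(x,p)$. The operations state graph $\mathcal O$ has as nodes the valid states: initial states $(w,\emptyset,w)$, $w\in V_r$ (all valid); non-terminal states $(w,S,v)$ with $w\in V_r$, $\emptyset\ne S\subseteq V_d$, $v\in S$, valid iff some valid operation $wsw''$ with $\{s\}=S$ has $s$ ending in $v$; terminal states $(w,S,w')$, $w'\in V_r$,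 $S\neq\emptyset$, valid iff some valid operation $wsw'$ has $\{s\}=S$. Non-terminal states are all states other than terminal ones (i.e. initial states and states $(w,S,v)$ with $v\in S$). -}

module Defs where

open import Data.Nat using (ℕ; _+_; _≤_)
open import Data.Fin using (Fin; toℕ) renaming (_<_ to _<ᶠ_)
open import Data.Fin.Subset using (Subset; Nonempty) renaming (_∈_ to _∈ₛ_)
open import Data.List using (List; []; _∷_; length; lookup; allFin; last; _++_)
open import Data.List.Membership.Propositional using (_∈_)
open import Data.List.Relation.Unary.Unique.Propositional using (Unique)
open import Data.List.Relation.Binary.Permutation.Propositional using (_↭_)
open import Data.Maybe using (Maybe; just)
open import Data.Product using (Σ; _×_; _,_; ∃-syntax)
open import Data.Sum using (_⊎_; inj₁; inj₂)
open import Function.Bundles using (_⇔_)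
open import Relation.Binary.PropositionalEquality using (_≡_)

-- Destinations V_d = Fin nd, listed in the reference order x = (v_1,...,v_nd)
-- (v_{i+1} is represented by i : Fin nd).  Replenishment locations V_r = Fin nr.

OpShape : ∀ {nd} → List (Fin nd) → Set
OpShape s = 1 ≤ length s × Unique s

Operation : ℕ → ℕ → Set
Operation nd nr = Fin nr × List (Fin nd) × Fin nr

-- Alternating sequences of operations and recharging legs, indexed by
-- start RL and end RL; consecutive pieces are connected.
data OpFirst  (nd nr : ℕ) : Fin nr → Fin nr → Set
data LegFirst (nd nr : ℕ) : Fin nr → Fin nr → Set

data OpFirst nd nr where
  lastOp : (w : Fin nr) (s : List (Fin nd)) (w' : Fin nr) → OpShape s → OpFirst nd nr w w'
  opThen : (w : Fin nr) (s : List (Fin nd)) (w' : Fin nr) {e : Fin nr} →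
           OpShape s → LegFirst nd nr w' e → OpFirst nd nr w e

data LegFirst nd nr where
  lastLeg : (w w' : Fin nr) → LegFirst nd nr w w'
  legThen : (w w' : Fin nr) {e : Fin nr} → OpFirst nd nr w' e → LegFirst nd nr w e

opsOp  : ∀ {nd nr a b} → OpFirst nd nr a b → List (Operation nd nr)
opsLeg : ∀ {nd nr a b} → LegFirst nd nr a b → List (Operation nd nr)
opsOp (lastOp w s w' _) = (w , s , w') ∷ []
opsOp (opThen w s w' _ t) = (w , s , w') ∷ opsLeg t
opsLeg (lastLeg _ _) = []
opsLeg (legThen _ _ t) = opsOp t

destsOp  : ∀ {nd nr a b} → OpFirst nd nr a b → List (Fin nd)
destsLeg : ∀ {nd nr a b} → LegFirst nd nr a b → List (Fin nd)
destsOp (lastOp _ s _ _) = s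
destsOp (opThen _ s _ _ t) = s ++ destsLeg t
destsLeg (lastLeg _ _) = []
destsLeg (legThen _ _ t) = destsOp t

PieceSeq : (nd nr : ℕ) → Fin nr → Fin nr → Set
PieceSeq nd nr w0 wt = OpFirst nd nr w0 wt ⊎ LegFirst nd nr w0 wt

ops : ∀ {nd nr w0 wt} → PieceSeq nd nr w0 wt → List (Operation nd nr)
ops (inj₁ t) = opsOp t
ops (inj₂ t) = opsLeg t

πd : ∀ {nd nr w0 wt} → PieceSeq nd nr w0 wt → List (Fin nd)
πd (inj₁ t) = destsOp t
πd (inj₂ t) = destsLeg t

IsDroneTour : ∀ {nd nr w0 wt} → PieceSeq nd nr w0 wt → Set
IsDroneTour {nd} t = πd t ↭ allFin nd

-- N_BS(x,p) for an ordering l of V_d (a permutation of x):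
-- σ(i) = position of v_i in l;  σ(i) < σ(j) whenever i + p ≤ j.
InNBS : ∀ {nd} → ℕ → List (Fin nd) → Set
InNBS p l = (a b : Fin (length l)) →
            toℕ (lookup l a) + p ≤ toℕ (lookup l b) → a <ᶠ b

InNBSR : ∀ {nd nr w0 wt} → ℕ → PieceSeq nd nr w0 wt → Set
InNBSR p t = IsDroneTour t × InNBS p (πd t)

ValidOp : (nd nr p : ℕ) (w0 wt : Fin nr) → Operation nd nr → Set
ValidOp nd nr p w0 wt o =
  ∃[ t ] (InNBSR {nd} {nr} {w0} {wt} p t × o ∈ ops t)

-- Non-terminal states of the operations state graph: initial states (w,∅,w)
-- and states (w,S,v) with v ∈ S.
data NTState (nd nr : ℕ) : Set where
  initial : Fin nr → NTState nd nr
  inner   : Fin nr → Subset nd → Fin nd → NTState nd nr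

data ValidNT (nd nr p : ℕ) (w0 wt : Fin nr) : NTState nd nr → Set where
  initial-valid : (w : Fin nr) → ValidNT nd nr p w0 wt (initial w)
  inner-valid   : (w : Fin nr) (S : Subset nd) (v : Fin nd) →
                  Nonempty S → v ∈ₛ S →
                  (s : List (Fin nd)) (w'' : Fin nr) →
                  ValidOp nd nr p w0 wt (w , s , w'') →
                  ((i : Fin nd) → (i ∈ₛ S) ⇔ (i ∈ s)) →
                  last s ≡ just v →
                  ValidNT nd nr p w0 wt (inner w S v)

-- A valid non-terminal state (w, S, v) comes from an operation whose destination
-- sequence s is an infix of the visiting order l = α ++ s ++ β of a tour in
-- N_BS(x,p), so S = (α ++ s) ∖ α and v is the last element of α ++ s.  Every
-- prefix γ of such an l is pinned down by its maximum m and p bits: an element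
-- i ≤ m with i + p ≤ m must lie in γ (otherwise it would come after m in l while
-- being at least p smaller), so only the p elements m, m − 1, …, m − p + 1 need a
-- bit.  Moreover v is within distance p below the maximum of α ++ s.  Hence a
-- state is determined by w, a code for α (empty, or one of n_d 2^p windows), a
-- window for α ++ s and an offset t < p, giving
-- n_r + n_r (1 + n_d 2^p) n_d 2^p p ≤ 3 n_d² n_r p 4^p states.
{-# OPTIONS --safe #-}
module Submission where

open import Defs
open import Data.Bool using (Bool; true; false; _∧_; _∨_; not)
open import Data.Bool.Properties using (⇔→≡)
open import Data.Empty using (⊥; ⊥-elim)
open import Data.Fin using (Fin; toℕ; fromℕ<)
open import Data.Fin.Properties using (toℕ<n; toℕ-fromℕ<; toℕ-injective; _≟_)
open import Data.Fin.Subset using (Subset) renaming (_∈_ to _∈ₛ_)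
open import Data.List
  using (List; []; _∷_; [_]; _++_; length; map; allFin; last; applyUpTo; cartesianProductWith; cartesianProduct)
open import Data.List.Properties
  using (length-++; length-map; length-applyUpTo; length-tabulate; ++-assoc; ++-identityʳ)
open import Data.List.Extrema.Nat using (argmax; argmax-sel; f[⊥]≤f[argmax]; f[xs]≤f[argmax])
open import Data.List.Membership.Propositional using (_∈_)
import Data.List.Membership.DecPropositional as DecMembership
open import Data.List.Membership.Propositional.Properties
  using (∈-++⁺ˡ; ∈-++⁺ʳ; ∈-++⁻; ∈-map⁺; ∈-allFin; ∈-cartesianProductWith⁺; ∈-cartesianProduct⁺)
open import Data.List.Relation.Binary.Subset.Propositional using (_⊆_)
open import Data.List.Relation.Binary.Permutation.Propositional using (_↭_; ↭-sym; ↭⇒↭ₛ)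
open import Data.List.Relation.Binary.Permutation.Propositional.Properties using (∈-resp-↭)
open import Data.List.Relation.Binary.Permutation.Setoid.Properties using (Unique-resp-↭)
open import Data.List.Relation.Unary.All using (All; _∷_)
import Data.List.Relation.Unary.All as All
open import Data.List.Relation.Unary.AllPairs using (_∷_)
open import Data.List.Relation.Unary.Any using (here; there; index)
open import Data.List.Relation.Unary.Any.Properties using (lookup-index)
open import Data.List.Relation.Unary.Unique.Propositional using (Unique)
open import Data.List.Relation.Unary.Unique.Propositional.Properties using (allFin⁺)
open import Data.Maybe using (Maybe; just; nothing)
open import Data.Nat using (ℕ; suc; _+_; _*_; _^_; _∸_; _≤_; _<_; _≤ᵇ_; z≤n; s≤s; >-nonZero)
open import Data.Nat.Properties
  using ( ≤-trans; ≤-<-trans; <-≤-trans; <⇒≤; <⇒≱; ≰⇒>; m<m+n; m∸n≤m; m∸[m∸n]≡n; m+n∸m≡n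
        ; ∸-monoˡ-<; ≤ᵇ-reflects-≤; +-mono-≤; +-monoˡ-≤; *-mono-≤; *-monoʳ-≤; m≤m*n; m≤n*m; m^n>0
        ; module ≤-Reasoning)
open import Data.Nat.Tactic.RingSolver using (solve-∀)
open import Data.Product using (_×_; _,_; ∃-syntax; ∃₂; proj₁; proj₂)
open import Data.Sum using (inj₁; inj₂; [_,_]′)
open import Data.Vec using (tabulate) renaming (lookup to lookupᵛ)
open import Data.Vec.Properties using (tabulate∘lookup; tabulate-cong; []=⇒lookup; lookup⇒[]=)
open import Function using (id)
open import Function.Bundles using (_⇔_; mk⇔; Equivalence)
open import Relation.Binary.PropositionalEquality
  using (_≡_; _≢_; refl; setoid; sym; trans; cong; cong₂; subst; subst₂; ≢-sym; module ≡-Reasoning)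
open import Relation.Nullary using (¬_; Dec; yes; no; does; ofʸ; ofⁿ)
open import Relation.Nullary.Decidable using (dec-true; dec-false)

private variable
  A B C : Set
  n nd nr p : ℕ
  x : A
  xs ys : List A

_∈?_ : (i : Fin n) (xs : List (Fin n)) → Dec (i ∈ xs)
_∈?_ {n} = DecMembership._∈?_ (_≟_ {n})

remove-∈ : x ∈ ys →
           ∃[ zs ] (length ys ≡ suc (length zs) × (∀ {y} → y ∈ ys → y ≢ x → y ∈ zs))
remove-∈ {ys = y ∷ ys} (here refl) = ys , refl , λ where
  (here y≡x) y≢x → ⊥-elim (y≢x y≡x)
  (there y∈ys) _ → y∈ys
remove-∈ {ys = y ∷ ys} (there x∈ys) with remove-∈ x∈ys
... | zs , |ys|≡ , keep = y ∷ zs , cong suc |ys|≡ , λ where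
  (here refl) _ → here refl
  (there z∈ys) z≢x → there (keep z∈ys z≢x)

Unique-⊆⇒length≤ : Unique xs → xs ⊆ ys → length xs ≤ length ys
Unique-⊆⇒length≤ {xs = []} _ _ = z≤n
Unique-⊆⇒length≤ {xs = x ∷ xs} (x≢xs ∷ unique) xs⊆ys with remove-∈ (xs⊆ys (here refl))
... | zs , |ys|≡ , keep rewrite |ys|≡ =
  s≤s (Unique-⊆⇒length≤ unique λ y∈xs →
         keep (xs⊆ys (there y∈xs)) (≢-sym (All.lookup x≢xs y∈xs)))

Unique-++⇒disjoint : ∀ xs → Unique (xs ++ ys) → x ∈ xs → x ∈ ys → ⊥
Unique-++⇒disjoint (_ ∷ xs) (x≢ ∷ _) (here refl) x∈ys = All.lookup x≢ (∈-++⁺ʳ xs x∈ys) refl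
Unique-++⇒disjoint (_ ∷ xs) (_ ∷ unique) (there x∈xs) x∈ys = Unique-++⇒disjoint xs unique x∈xs x∈ys

↭-allFin⇒Unique : xs ↭ allFin n → Unique xs
↭-allFin⇒Unique {n = n} xs↭ = Unique-resp-↭ (setoid _) (↭⇒↭ₛ (↭-sym xs↭)) (allFin⁺ n)

↭-allFin⇒∈ : xs ↭ allFin n → ∀ i → i ∈ xs
↭-allFin⇒∈ xs↭ i = ∈-resp-↭ (↭-sym xs↭) (∈-allFin i)

last≡just⇒∷ʳ : (xs : List A) → last xs ≡ just x → ∃[ ys ] (xs ≡ ys ++ [ x ])
last≡just⇒∷ʳ (y ∷ []) refl = [] , refl
last≡just⇒∷ʳ (y ∷ z ∷ zs) last≡ with last≡just⇒∷ʳ (z ∷ zs) last≡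
... | ys , zs≡ = y ∷ ys , cong (y ∷_) zs≡

maximum : {xs : List (Fin n)} {i : Fin n} → i ∈ xs →
          ∃[ m ] (m ∈ xs × All (λ k → toℕ k ≤ toℕ m) xs)
maximum {xs = y ∷ ys} _ =
  argmax toℕ y ys , argmax∈ , f[⊥]≤f[argmax] {f = toℕ} y ys ∷ f[xs]≤f[argmax] {f = toℕ} y ys
  where
  argmax∈ : argmax toℕ y ys ∈ y ∷ ys
  argmax∈ with argmax-sel toℕ y ys
  ... | inj₁ ≡y = here ≡y
  ... | inj₂ ∈ys = there ∈ys

length-cartesianProductWith : (f : A → B → C) (xs : List A) (ys : List B) →
  length (cartesianProductWith f xs ys) ≡ length xs * length ys
length-cartesianProductWith f [] ys = refl
length-cartesianProductWith f (x ∷ xs) ys = begin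
  length (map (f x) ys ++ cartesianProductWith f xs ys)
    ≡⟨ length-++ (map (f x) ys) ⟩
  length (map (f x) ys) + length (cartesianProductWith f xs ys)
    ≡⟨ cong₂ _+_ (length-map (f x) ys) (length-cartesianProductWith f xs ys) ⟩
  length ys + length xs * length ys ∎
  where open ≡-Reasoning

index-∈-++⁺ˡ< : (x∈xs : x ∈ xs) → toℕ (index (∈-++⁺ˡ {ys = ys} x∈xs)) < length xs
index-∈-++⁺ˡ< (here _) = s≤s z≤n
index-∈-++⁺ˡ< (there x∈xs) = s≤s (index-∈-++⁺ˡ< x∈xs)

index-∈-++⁺ʳ≥ : ∀ xs (x∈ys : x ∈ ys) → length xs ≤ toℕ (index (∈-++⁺ʳ xs x∈ys))
index-∈-++⁺ʳ≥ [] _ = z≤n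
index-∈-++⁺ʳ≥ (_ ∷ xs) x∈ys = s≤s (index-∈-++⁺ʳ≥ xs x∈ys)

n≤m<n+o⇒m∸n<o : ∀ {m n o} → n ≤ m → m < n + o → m ∸ n < o
n≤m<n+o⇒m∸n<o {n = n} {o} n≤m m<n+o = subst (_ <_) (m+n∸m≡n n o) (∸-monoˡ-< m<n+o n≤m)

-- Tours and the neighbourhood N_BS

opsOp-infix : ∀ {a b w s w'} (t : OpFirst nd nr a b) → (w , s , w') ∈ opsOp t →
              ∃₂ λ α β → destsOp t ≡ α ++ s ++ β
opsLeg-infix : ∀ {a b w s w'} (t : LegFirst nd nr a b) → (w , s , w') ∈ opsLeg t →
               ∃₂ λ α β → destsLeg t ≡ α ++ s ++ β
opsOp-infix (lastOp _ s _ _) (here refl) = [] , [] , sym (++-identityʳ s)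
opsOp-infix (opThen _ s _ _ t) (here refl) = [] , destsLeg t , refl
opsOp-infix {s = s} (opThen _ s₀ _ _ t) (there o∈t) with opsLeg-infix t o∈t
... | α , β , dests≡ = s₀ ++ α , β , trans (cong (s₀ ++_) dests≡) (sym (++-assoc s₀ α (s ++ β)))
opsLeg-infix (legThen _ _ t) o∈t = opsOp-infix t o∈t

ops-infix : ∀ {w0 wt w s w'} (t : PieceSeq nd nr w0 wt) → (w , s , w') ∈ ops t →
            ∃₂ λ α β → πd t ≡ α ++ s ++ β
ops-infix (inj₁ t) = opsOp-infix t
ops-infix (inj₂ t) = opsLeg-infix t

ValidOp⇒infix : ∀ {w0 wt w s w'} → ValidOp nd nr p w0 wt (w , s , w') →
  ∃₂ λ α β → InNBS p (α ++ s ++ β) × (α ++ s ++ β) ↭ allFin nd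
ValidOp⇒infix {p = p} (t , (tour , nbs) , o∈t) with ops-infix t o∈t
... | α , β , πd≡ = α , β , subst (InNBS p) πd≡ nbs , subst (_↭ allFin _) πd≡ tour

InNBS-++⇒separated : ∀ {γ δ : List (Fin n)} {i j} → InNBS p (γ ++ δ) →
                     i ∈ δ → j ∈ γ → ¬ (toℕ i + p ≤ toℕ j)
InNBS-++⇒separated {p = p} {γ} {δ} nbs i∈δ j∈γ i+p≤j =
  <⇒≱ a<b (<⇒≤ (<-≤-trans (index-∈-++⁺ˡ< j∈γ) (index-∈-++⁺ʳ≥ γ i∈δ)))
  where
  a<b = nbs (index (∈-++⁺ʳ γ i∈δ)) (index (∈-++⁺ˡ {ys = δ} j∈γ))
            (subst₂ (λ u v → toℕ u + p ≤ toℕ v)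
                    (lookup-index (∈-++⁺ʳ γ i∈δ)) (lookup-index (∈-++⁺ˡ {ys = δ} j∈γ)) i+p≤j)

max<last+p : ∀ {γ δ : List (Fin n)} {v m} → 1 ≤ p → InNBS p (γ ++ v ∷ δ) →
             m ∈ γ ++ [ v ] → toℕ m < toℕ v + p
max<last+p {γ = γ} 1≤p nbs m∈ with ∈-++⁻ γ m∈
... | inj₁ m∈γ = ≰⇒> (InNBS-++⇒separated nbs (here refl) m∈γ)
... | inj₂ (here refl) = m<m+n _ 1≤p

-- Prefix codes

bitStrings : ℕ → List (List Bool)
bitStrings 0 = [ [] ]
bitStrings (suc n) = cartesianProductWith _∷_ (true ∷ false ∷ []) (bitStrings n)

length-bitStrings : ∀ n → length (bitStrings n) ≡ 2 ^ n
length-bitStrings 0 = refl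
length-bitStrings (suc n) =
  trans (length-cartesianProductWith _∷_ (true ∷ false ∷ []) (bitStrings n))
        (cong (2 *_) (length-bitStrings n))

∈-bitStrings : (bs : List Bool) → bs ∈ bitStrings (length bs)
∈-bitStrings [] = here refl
∈-bitStrings (b ∷ bs) = ∈-cartesianProductWith⁺ _∷_ (∈-Bools b) (∈-bitStrings bs)
  where
  ∈-Bools : ∀ b → b ∈ true ∷ false ∷ []
  ∈-Bools true = here refl
  ∈-Bools false = there (here refl)

bitAt : List Bool → ℕ → Bool
bitAt [] _ = false
bitAt (b ∷ _) 0 = b
bitAt (_ ∷ bs) (suc j) = bitAt bs j

bitAt-applyUpTo : ∀ (f : ℕ → Bool) {n j} → j < n → bitAt (applyUpTo f n) j ≡ f j
bitAt-applyUpTo f {suc n} {0} _ = refl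
bitAt-applyUpTo f {suc n} {suc j} (s≤s j<n) = bitAt-applyUpTo (λ k → f (suc k)) j<n

_∸ᶠ_ : Fin n → ℕ → Fin n
m ∸ᶠ t = fromℕ< (≤-<-trans (m∸n≤m (toℕ m) t) (toℕ<n m))

∸ᶠ-∸ : ∀ {m i : Fin n} → toℕ i ≤ toℕ m → m ∸ᶠ (toℕ m ∸ toℕ i) ≡ i
∸ᶠ-∸ i≤m = toℕ-injective (trans (toℕ-fromℕ< _) (m∸[m∸n]≡n i≤m))

-- (m , bs) stands for the set of i ≤ m with i + p ≤ m or with bit m − i of bs set.
Window : ℕ → Set
Window n = Fin n × List Bool

inWindow : ℕ → Window n → Fin n → Bool
inWindow p (m , bs) i =
  (toℕ i ≤ᵇ toℕ m) ∧ ((toℕ i + p ≤ᵇ toℕ m) ∨ bitAt bs (toℕ m ∸ toℕ i))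

windowOf : ℕ → List (Fin n) → Fin n → Window n
windowOf p γ m = m , applyUpTo (λ j → does ((m ∸ᶠ j) ∈? γ)) p

windows : (n p : ℕ) → List (Window n)
windows n p = cartesianProduct (allFin n) (bitStrings p)

windowOf∈windows : ∀ γ (m : Fin n) → windowOf p γ m ∈ windows n p
windowOf∈windows {p = p} γ m =
  ∈-cartesianProduct⁺ (∈-allFin m)
    (subst (λ k → bits ∈ bitStrings k) (length-applyUpTo _ p) (∈-bitStrings bits))
  where bits = proj₂ (windowOf p γ m)

windowOf-decodes : ∀ {γ δ : List (Fin n)} {m} → InNBS p (γ ++ δ) → (∀ i → i ∈ γ ++ δ) →
                   m ∈ γ → All (λ k → toℕ k ≤ toℕ m) γ →
                   ∀ i → inWindow p (windowOf p γ m) i ≡ does (i ∈? γ)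
windowOf-decodes {p = p} {γ} {m = m} nbs covers m∈γ γ≤m i
  with toℕ i ≤ᵇ toℕ m | ≤ᵇ-reflects-≤ (toℕ i) (toℕ m)
... | false | ofⁿ i≰m = sym (dec-false (i ∈? γ) λ i∈γ → i≰m (All.lookup γ≤m i∈γ))
... | true | ofʸ i≤m with toℕ i + p ≤ᵇ toℕ m | ≤ᵇ-reflects-≤ (toℕ i + p) (toℕ m)
...   | true | ofʸ i+p≤m = sym (dec-true (i ∈? γ)
  ([ id , (λ i∈δ → ⊥-elim (InNBS-++⇒separated nbs i∈δ m∈γ i+p≤m)) ]′ (∈-++⁻ γ (covers i))))
...   | false | ofⁿ i+p≰m = begin
  bitAt (applyUpTo (λ j → does ((m ∸ᶠ j) ∈? γ)) p) (toℕ m ∸ toℕ i)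
    ≡⟨ bitAt-applyUpTo _ (n≤m<n+o⇒m∸n<o i≤m (≰⇒> i+p≰m)) ⟩
  does ((m ∸ᶠ (toℕ m ∸ toℕ i)) ∈? γ)
    ≡⟨ cong (λ k → does (k ∈? γ)) (∸ᶠ-∸ i≤m) ⟩
  does (i ∈? γ) ∎
  where open ≡-Reasoning

prefixCodes : (n p : ℕ) → List (Maybe (Window n))
prefixCodes n p = nothing ∷ map just (windows n p)

inPrefix : ℕ → Maybe (Window n) → Fin n → Bool
inPrefix p nothing _ = false
inPrefix p (just win) i = inWindow p win i

prefixCode-complete : ∀ {γ δ : List (Fin n)} → InNBS p (γ ++ δ) → (∀ i → i ∈ γ ++ δ) →
  ∃[ c ] (c ∈ prefixCodes n p × (∀ i → inPrefix p c i ≡ does (i ∈? γ)))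
prefixCode-complete {γ = []} _ _ = nothing , here refl , λ _ → refl
prefixCode-complete {p = p} {γ = γ@(_ ∷ _)} nbs covers with maximum {xs = γ} (here refl)
... | m , m∈γ , γ≤m =
  just (windowOf p γ m) , there (∈-map⁺ just (windowOf∈windows γ m)) ,
  windowOf-decodes nbs covers m∈γ γ≤m

∈-infix⇔difference : ∀ (α : List (Fin n)) {s β i} → Unique (α ++ s ++ β) →
  i ∈ s ⇔ (does (i ∈? (α ++ s)) ∧ not (does (i ∈? α)) ≡ true)
∈-infix⇔difference α {s} {i = i} unique with i ∈? (α ++ s) | i ∈? α
... | yes _ | yes i∈α =
  mk⇔ (λ i∈s → ⊥-elim (Unique-++⇒disjoint α unique i∈α (∈-++⁺ˡ i∈s))) λ ()
... | yes i∈α++s | no i∉α =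
  mk⇔ (λ _ → refl) λ _ → [ (λ i∈α → ⊥-elim (i∉α i∈α)) , id ]′ (∈-++⁻ α i∈α++s)
... | no i∉α++s | _ = mk⇔ (λ i∈s → ⊥-elim (i∉α++s (∈-++⁺ʳ α i∈s))) λ ()

Subset-of-infix : ∀ (α : List (Fin n)) {s β} {S : Subset n} → Unique (α ++ s ++ β) →
  (∀ i → (i ∈ₛ S) ⇔ (i ∈ s)) →
  ∀ i → lookupᵛ S i ≡ does (i ∈? (α ++ s)) ∧ not (does (i ∈? α))
Subset-of-infix α {S = S} unique S⇔s i = ⇔→≡ (mk⇔
  (λ Sᵢ≡true → to (∈-infix⇔difference α unique) (to (S⇔s i) (lookup⇒[]= i S Sᵢ≡true)))
  (λ ≡true → []=⇒lookup (from (S⇔s i) (from (∈-infix⇔difference α unique) ≡true))))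
  where open Equivalence

StateCode : (nd nr p : ℕ) → Set
StateCode nd nr p = Fin nr × Maybe (Window nd) × Window nd × Fin p

decodeState : ∀ p → StateCode nd nr p → NTState nd nr
decodeState p (w , c , win , t) =
  inner w (tabulate λ i → inWindow p win i ∧ not (inPrefix p c i)) (proj₁ win ∸ᶠ toℕ t)

stateCodes : (nd nr p : ℕ) → List (StateCode nd nr p)
stateCodes nd nr p =
  cartesianProduct (allFin nr) (cartesianProduct (prefixCodes nd p) (cartesianProduct (windows nd p) (allFin p)))

candidateStates : (nd nr p : ℕ) → List (NTState nd nr)
candidateStates nd nr p = map initial (allFin nr) ++ map (decodeState p) (stateCodes nd nr p)

ValidNT⇒∈candidateStates : ∀ {w0 wt st} → 1 ≤ p → ValidNT nd nr p w0 wt st →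
                           st ∈ candidateStates nd nr p
ValidNT⇒∈candidateStates _ (initial-valid w) = ∈-++⁺ˡ (∈-map⁺ initial (∈-allFin w))
ValidNT⇒∈candidateStates {p} {nd} {nr} 1≤p (inner-valid w S v _ _ s _ valid S⇔s last≡v)
  with last≡just⇒∷ʳ s last≡v
... | s′ , refl with ValidOp⇒infix valid
... | α , β , nbs , l↭ with maximum {xs = α ++ s′ ++ [ v ]} (∈-++⁺ʳ α (∈-++⁺ʳ s′ (here refl)))
                          | prefixCode-complete {γ = α} nbs (↭-allFin⇒∈ l↭)
... | m , m∈γ , γ≤m | c , c∈ , c-decodes =
  subst (_∈ candidateStates nd nr p) (sym state≡) (∈-++⁺ʳ _ (∈-map⁺ (decodeState p) code∈))
  where
  γ = α ++ s′ ++ [ v ]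
  l≡γ++β : α ++ (s′ ++ [ v ]) ++ β ≡ γ ++ β
  l≡γ++β = sym (++-assoc α (s′ ++ [ v ]) β)
  l≡γ′++v∷β : α ++ (s′ ++ [ v ]) ++ β ≡ (α ++ s′) ++ v ∷ β
  l≡γ′++v∷β = trans (cong (α ++_) (++-assoc s′ [ v ] β)) (sym (++-assoc α s′ (v ∷ β)))
  v≤m : toℕ v ≤ toℕ m
  v≤m = All.lookup γ≤m (∈-++⁺ʳ α (∈-++⁺ʳ s′ (here refl)))
  t<p : toℕ m ∸ toℕ v < p
  t<p = n≤m<n+o⇒m∸n<o v≤m (max<last+p 1≤p (subst (InNBS p) l≡γ′++v∷β nbs)
                                          (subst (m ∈_) (sym (++-assoc α s′ [ v ])) m∈γ))
  code : StateCode nd nr p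
  code = w , c , windowOf p γ m , fromℕ< t<p
  code∈ : code ∈ stateCodes nd nr p
  code∈ = ∈-cartesianProduct⁺ (∈-allFin w) (∈-cartesianProduct⁺ c∈
            (∈-cartesianProduct⁺ (windowOf∈windows γ m) (∈-allFin _)))
  window-decodes : ∀ i → inWindow p (windowOf p γ m) i ≡ does (i ∈? γ)
  window-decodes = windowOf-decodes (subst (InNBS p) l≡γ++β nbs)
                     (λ i → subst (i ∈_) l≡γ++β (↭-allFin⇒∈ l↭ i)) m∈γ γ≤m
  S≡ : S ≡ tabulate (λ i → inWindow p (windowOf p γ m) i ∧ not (inPrefix p c i))
  S≡ = trans (sym (tabulate∘lookup S)) (tabulate-cong λ i →
         trans (Subset-of-infix α (↭-allFin⇒Unique l↭) S⇔s i)
               (sym (cong₂ (λ b b′ → b ∧ not b′) (window-decodes i) (c-decodes i))))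
  v≡ : v ≡ m ∸ᶠ toℕ (fromℕ< t<p)
  v≡ = sym (trans (cong (m ∸ᶠ_) (toℕ-fromℕ< t<p)) (∸ᶠ-∸ v≤m))
  state≡ : inner w S v ≡ decodeState p code
  state≡ = cong₂ (inner w) S≡ v≡

-- Counting

length-cartesianProduct : (xs : List A) (ys : List B) →
                          length (cartesianProduct xs ys) ≡ length xs * length ys
length-cartesianProduct = length-cartesianProductWith _,_

length-allFin : ∀ n → length (allFin n) ≡ n
length-allFin n = length-tabulate id

length-windows : ∀ n p → length (windows n p) ≡ n * 2 ^ p
length-windows n p = trans (length-cartesianProduct (allFin n) (bitStrings p))
                           (cong₂ _*_ (length-allFin n) (length-bitStrings p))

length-prefixCodes : ∀ n p → length (prefixCodes n p) ≡ suc (n * 2 ^ p)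
length-prefixCodes n p = cong suc (trans (length-map just (windows n p)) (length-windows n p))

length-stateCodes : ∀ nd nr p →
  length (stateCodes nd nr p) ≡ nr * (suc (nd * 2 ^ p) * (nd * 2 ^ p * p))
length-stateCodes nd nr p =
  trans (length-cartesianProduct (allFin nr) codes₁) (cong₂ _*_ (length-allFin nr)
    (trans (length-cartesianProduct (prefixCodes nd p) codes₂) (cong₂ _*_ (length-prefixCodes nd p)
      (trans (length-cartesianProduct (windows nd p) (allFin p))
             (cong₂ _*_ (length-windows nd p) (length-allFin p))))))
  where
  codes₂ = cartesianProduct (windows nd p) (allFin p)
  codes₁ = cartesianProduct (prefixCodes nd p) codes₂

length-candidateStates : ∀ nd nr p →
  length (candidateStates nd nr p) ≡ nr + nr * (suc (nd * 2 ^ p) * (nd * 2 ^ p * p))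
length-candidateStates nd nr p = trans (length-++ (map initial (allFin nr)))
  (cong₂ _+_ (trans (length-map initial (allFin nr)) (length-allFin nr))
             (trans (length-map (decodeState p) (stateCodes nd nr p)) (length-stateCodes nd nr p)))

4^n≡2^n*2^n : ∀ n → 4 ^ n ≡ 2 ^ n * 2 ^ n
4^n≡2^n*2^n 0 = refl
4^n≡2^n*2^n (suc n) = trans (cong (4 *_) (4^n≡2^n*2^n n)) (double (2 ^ n))
  where
  double : ∀ a → 4 * (a * a) ≡ 2 * a * (2 * a)
  double = solve-∀

length-candidateStates≤ : 1 ≤ nd → 1 ≤ p →
  length (candidateStates nd nr p) ≤ 3 * (nd ^ 2 * nr * p * 4 ^ p)
length-candidateStates≤ {nd} {p} {nr} 1≤nd 1≤p = begin
  length (candidateStates nd nr p)       ≡⟨ length-candidateStates nd nr p ⟩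
  nr + nr * (suc W * (W * p))            ≡⟨ expand nr W p ⟩
  nr + (nr * (W * p) + T)                ≤⟨ +-mono-≤ nr≤T (+-monoˡ-≤ T nrWp≤T) ⟩
  T + (T + T)                            ≡⟨ collect nd nr p (2 ^ p) ⟨
  3 * (nd ^ 2 * nr * p * (2 ^ p * 2 ^ p)) ≡⟨ cong (λ q → 3 * (nd ^ 2 * nr * p * q)) (4^n≡2^n*2^n p) ⟨
  3 * (nd ^ 2 * nr * p * 4 ^ p)          ∎
  where
  open ≤-Reasoning
  W = nd * 2 ^ p
  T = nr * (W * (W * p))
  1≤W : 1 ≤ W
  1≤W = *-mono-≤ 1≤nd (m^n>0 2 p)
  nr≤T : nr ≤ T
  nr≤T = m≤m*n nr (W * (W * p)) {{>-nonZero (*-mono-≤ 1≤W (*-mono-≤ 1≤W 1≤p))}}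
  nrWp≤T : nr * (W * p) ≤ T
  nrWp≤T = *-monoʳ-≤ nr (m≤n*m (W * p) W {{>-nonZero 1≤W}})
  expand : ∀ r w q → r + r * (suc w * (w * q)) ≡ r + (r * (w * q) + r * (w * (w * q)))
  expand = solve-∀
  -- n * (n * 1) is the normal form of n ^ 2, which the solver does not accept.
  collect : ∀ n r q b → 3 * (n * (n * 1) * r * q * (b * b)) ≡
            r * (n * b * (n * b * q)) + (r * (n * b * (n * b * q)) + r * (n * b * (n * b * q)))
  collect = solve-∀

lemma5 : ∃[ C ] ((nd nr p : ℕ) (w0 wt : Fin nr) → 1 ≤ nd → 1 ≤ p →
           (L : List (NTState nd nr)) → Unique L → All (ValidNT nd nr p w0 wt) L →
           length L ≤ C * (nd ^ 2 * nr * p * 4 ^ p))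
lemma5 = 3 , λ nd nr p w0 wt 1≤nd 1≤p L unique valid →
  ≤-trans (Unique-⊆⇒length≤ unique λ st∈L → ValidNT⇒∈candidateStates 1≤p (All.lookup valid st∈L))
          (length-candidateStates≤ 1≤nd 1≤p)
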